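{- Let $T'$ be any refinement of the parity decision tree $T$ over $\{ -1,1\}^n$. Then $$\mathbf{E}_{\ell \in T} \Big(\sum_{i=1}^n \ell_i\Big)^2 \le \mathbf{E}_{\ell' \in T'} \Big(\sum_{i=1}^n \ell_i'\Big)^2.$$
   Context: A parity decision tree over $\{ -1,1\}^n$ is a rooted full binary tree in which each internal node is labelled by a set $S\subseteq[n]$ and its two outgoing edges are labelled $-1$ and $1$; an input $x$ follows, at a node labelled $S$, the edge labelled $\prod_{i\in S}x_i$, reaching a unique leaf. A refinement of $T$ is a parity decision tree obtained from $T$ by replacing leaves with subtrees of further parity queries. Each leaf is represented by the vector $\ell\in\{ -1,0,1\}^n$ where $\ell_i$ is the average of $x_i$ over inputs reaching that leaf; $\mathbf{E}_{\ell\in T}$ is over the leaf reached by a uniformly random $x\in\{ -1,1\}^n$. -}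

module Defs where

open import Data.Nat using (ℕ; zero; suc)
open import Data.Bool using (Bool; true; false; if_then_else_; _xor_; _∧_)
open import Data.Bool.Properties using () renaming (_≟_ to _≟B_)
open import Data.Vec as V using (Vec; []; _∷_)
open import Data.List as L using (List; []; _∷_)
open import Data.List.Properties using (≡-dec)
open import Data.Fin using (Fin)
open import Data.Rational using (ℚ; 0ℚ; 1ℚ; -_; _+_; _*_; _/_)
open import Data.Integer using (+_)

-- An input x ∈ {-1,1}^n is encoded as a Vec Bool n: true ↦ -1, false ↦ 1.
Input : ℕ → Set
Input n = Vec Bool n

sgn : Bool → ℚ
sgn true  = - 1ℚ
sgn false = 1ℚ

allInputs : (n : ℕ) → List (Input n)
allInputs zero    = [] ∷ []
allInputs (suc n) = L.map (true ∷_) (allInputs n) L.++ L.map (false ∷_) (allInputs n)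

-- A subset S ⊆ [n] is a characteristic vector (true = member).
-- parity S x = true  iff  ∏_{i∈S} x_i = -1.
parity : {n : ℕ} → Vec Bool n → Input n → Bool
parity S x = V.foldr _ _xor_ false (V.zipWith _∧_ S x)

-- Parity decision trees: node S t₋ t₊, t₋ followed when ∏_{i∈S} x_i = -1.
data PDT (n : ℕ) : Set where
  leaf : PDT n
  node : Vec Bool n → PDT n → PDT n → PDT n

-- The leaf reached by x, identified by the sequence of edges taken (true = edge -1).
path : {n : ℕ} → PDT n → Input n → List Bool
path leaf           x = []
path (node S m p) x = if parity S x then true ∷ path m x else false ∷ path p x

data _≼_ {n : ℕ} : PDT n → PDT n → Set where
  leaf≼ : (T' : PDT n) → leaf ≼ T'
  node≼ : {S : Vec Bool n} {a b a' b' : PDT n} →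
          a ≼ a' → b ≼ b' → node S a b ≼ node S a' b'

sumℚ : List ℚ → ℚ
sumℚ = L.foldr _+_ 0ℚ

-- arithmetic mean of a list (0 for the empty list; never used on empty lists below)
avg : List ℚ → ℚ
avg []        = 0ℚ
avg (q ∷ qs)  = sumℚ (q ∷ qs) * ((+ 1) / suc (L.length qs))

reachers : {n : ℕ} → PDT n → Input n → List (Input n)
reachers {n} T x = L.filter (λ y → ≡-dec _≟B_ (path T y) (path T x)) (allInputs n)

-- the leaf vector ℓ of the leaf reached by x: ℓ_i = average of y_i over y reaching that leaf
leafVec : {n : ℕ} → PDT n → Input n → Fin n → ℚ
leafVec T x i = avg (L.map (λ y → sgn (V.lookup y i)) (reachers T x))

sumFin : (n : ℕ) → (Fin n → ℚ) → ℚ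
sumFin n f = sumℚ (L.map f (L.allFin n))

-- E_{ℓ ∈ T} (Σ_i ℓ_i)^2, expectation over the leaf reached by uniform x
potential : {n : ℕ} → PDT n → ℚ
potential {n} T =
  avg (L.map (λ x → sumFin n (leafVec T x) * sumFin n (leafVec T x)) (allInputs n))

module Submission where

-- For a list U of inputs (a finite multiset) and a weight
-- f : Input n → ℚ, define the energy of a tree T on U as
--     energy T U = Σ_{x ∈ U} (mean of f over the inputs of U in x's leaf)²
--                = Σ_{leaves L} |L ∩ U| · (mean of f on L ∩ U)².
-- (1) A node splits U by the parity of its query, and the energy of a node
--     is the sum of the energies of its two subtrees on the two halves.
-- (2) Splitting a leaf never decreases the energy: this is the weighted
--     convexity inequality (m₁ + m₀) c² ≤ m₁ a² + m₀ b² for the weighted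
--     mean c of a and b, i.e. Jensen's inequality for the square.
-- By induction on the refinement relation, (1) and (2) show that energy is
-- monotone under refinement, for every U and every f.
-- Finally, by linearity of averages, Σ_i ℓ_i at the leaf of x is the mean
-- of f(y) = Σ_i y_i over the inputs y reaching that leaf, so the potential
-- of T is the average over all inputs of the summand of the energy on all
-- inputs with this f; monotonicity of averages finishes the proof.

open import Defs
open import Data.Nat using (ℕ)
open import Data.Rational using (_≤_)

open import Data.Nat using (suc)
open import Data.Bool using (Bool; true; false; _∧_)
open import Data.Bool.Properties using () renaming (_≟_ to _≟B_)
open import Data.List as L using (List; []; _∷_)
open import Data.List.Properties using (≡-dec; length-map; map-cong; filter-all)
open import Data.List.Relation.Unary.All using (universal)
open import Data.Vec as V using ()
open import Data.Integer as Z using ()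
import Data.Integer.Properties as ZP
open import Data.Rational
  using (ℚ; 0ℚ; 1ℚ; _+_; _*_; _-_; _/_; 1/_; nonNegative; nonPositive)
open import Data.Rational.Properties
open import Data.Rational.Literals using (fromℤ)
open import Data.Rational.Solver using (module +-*-Solver)
open import Data.Sum using (inj₁; inj₂)
open import Relation.Binary.PropositionalEquality
open import Relation.Nullary using (does)
open import Relation.Unary using (Pred; Decidable)
open import Level using (0ℓ)

open +-*-Solver

ι : ℕ → ℚ
ι k = fromℤ (Z.+ k)

ι-suc : ∀ k → ι (suc k) ≡ 1ℚ + ι k
ι-suc k = sym (trans (/-cong numerator refl) (normalize-coprime _))
  where
  numerator : Z.+ 1 Z.* Z.+ 1 Z.+ Z.+ k Z.* Z.+ 1 ≡ Z.+ suc k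
  numerator = cong (λ z → Z.+ 1 Z.+ z) (ZP.*-identityʳ (Z.+ k))

ι-suc-inverse : ∀ k → ι (suc k) * (Z.+ 1 / suc k) ≡ 1ℚ
ι-suc-inverse k = trans (cong (ι (suc k) *_) reciprocal) (*-inverseʳ (ι (suc k)))
  where
  reciprocal : Z.+ 1 / suc k ≡ 1/ ι (suc k)
  reciprocal = normalize-coprime _

0≤*-nonNeg : ∀ x y → 0ℚ ≤ x → 0ℚ ≤ y → 0ℚ ≤ x * y
0≤*-nonNeg x y 0≤x 0≤y =
  nonNegative⁻¹ (x * y) {{nonNeg*nonNeg⇒nonNeg x {{nonNegative 0≤x}} y {{nonNegative 0≤y}}}}

0≤square : ∀ x → 0ℚ ≤ x * x
0≤square x with ≤-total 0ℚ x
... | inj₁ 0≤x = 0≤*-nonNeg x x 0≤x 0≤x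
... | inj₂ x≤0 =
  nonNegative⁻¹ (x * x) {{nonPos*nonPos⇒nonPos x {{nonPositive x≤0}} x {{nonPositive x≤0}}}}

-- Weighted variance decomposition: the weighted second moment of a, b equals
-- (total weight)·c² plus the weighted squared deviations from c, plus a term
-- that vanishes exactly when c is the weighted mean.
second-moment-decomposition : ∀ m₁ m₀ a b c →
  m₁ * (a * a) + m₀ * (b * b) ≡
  ((m₁ + m₀) * (c * c) + (m₁ * ((a - c) * (a - c)) + m₀ * ((b - c) * (b - c))))
    + (c + c) * ((m₁ * a + m₀ * b) - (m₁ + m₀) * c)
second-moment-decomposition = solve 5 (λ m₁ m₀ a b c →
  m₁ :* (a :* a) :+ m₀ :* (b :* b) :=
  ((m₁ :+ m₀) :* (c :* c) :+ (m₁ :* ((a :- c) :* (a :- c)) :+ m₀ :* ((b :- c) :* (b :- c))))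
    :+ (c :+ c) :* ((m₁ :* a :+ m₀ :* b) :- (m₁ :+ m₀) :* c)) refl

weighted-jensen : ∀ m₁ m₀ a b c → 0ℚ ≤ m₁ → 0ℚ ≤ m₀ →
  m₁ * a + m₀ * b ≡ (m₁ + m₀) * c →
  (m₁ + m₀) * (c * c) ≤ m₁ * (a * a) + m₀ * (b * b)
weighted-jensen m₁ m₀ a b c 0≤m₁ 0≤m₀ mean = begin
  p          ≡⟨ sym (+-identityʳ p) ⟩
  p + 0ℚ     ≤⟨ +-monoʳ-≤ p 0≤deviation ⟩
  p + q      ≡⟨ sym (+-identityʳ (p + q)) ⟩
  p + q + 0ℚ ≡⟨ cong (p + q +_) (sym cross-term-vanishes) ⟩
  p + q + (c + c) * ((m₁ * a + m₀ * b) - (m₁ + m₀) * c)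
             ≡⟨ sym (second-moment-decomposition m₁ m₀ a b c) ⟩
  m₁ * (a * a) + m₀ * (b * b) ∎
  where
  open ≤-Reasoning
  p = (m₁ + m₀) * (c * c)
  q = m₁ * ((a - c) * (a - c)) + m₀ * ((b - c) * (b - c))
  0≤deviation : 0ℚ ≤ q
  0≤deviation = +-mono-≤ (0≤*-nonNeg m₁ _ 0≤m₁ (0≤square (a - c)))
                         (0≤*-nonNeg m₀ _ 0≤m₀ (0≤square (b - c)))
  cross-term-vanishes : (c + c) * ((m₁ * a + m₀ * b) - (m₁ + m₀) * c) ≡ 0ℚ
  cross-term-vanishes = begin-equality
    (c + c) * ((m₁ * a + m₀ * b) - (m₁ + m₀) * c)
      ≡⟨ cong (λ z → (c + c) * (z - (m₁ + m₀) * c)) mean ⟩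
    (c + c) * ((m₁ + m₀) * c - (m₁ + m₀) * c)
      ≡⟨ cong ((c + c) *_) (+-inverseʳ ((m₁ + m₀) * c)) ⟩
    (c + c) * 0ℚ
      ≡⟨ *-zeroʳ (c + c) ⟩
    0ℚ ∎

module _ {X : Set} where

  count : List X → ℚ
  count V = sumℚ (L.map (λ _ → 1ℚ) V)

  count≡length : ∀ V → count V ≡ ι (L.length V)
  count≡length [] = refl
  count≡length (v ∷ vs) = trans (cong (1ℚ +_) (count≡length vs)) (sym (ι-suc (L.length vs)))

  0≤count : ∀ V → 0ℚ ≤ count V
  0≤count V rewrite count≡length V = nonNegative⁻¹ (ι (L.length V))

  sum-const : ∀ (V : List X) k → sumℚ (L.map (λ _ → k) V) ≡ count V * k
  sum-const [] k = sym (*-zeroˡ k)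
  sum-const (v ∷ vs) k = begin
    k + sumℚ (L.map (λ _ → k) vs) ≡⟨ cong (k +_) (sum-const vs k) ⟩
    k + count vs * k              ≡⟨ cong (_+ count vs * k) (sym (*-identityˡ k)) ⟩
    1ℚ * k + count vs * k         ≡⟨ sym (*-distribʳ-+ k 1ℚ (count vs)) ⟩
    (1ℚ + count vs) * k           ∎
    where open ≡-Reasoning

  sum-zero : ∀ (V : List X) → sumℚ (L.map (λ _ → 0ℚ) V) ≡ 0ℚ
  sum-zero V = trans (sum-const V 0ℚ) (*-zeroʳ (count V))

  sum-+ : ∀ (F G : X → ℚ) V →
    sumℚ (L.map (λ x → F x + G x) V) ≡ sumℚ (L.map F V) + sumℚ (L.map G V)
  sum-+ F G [] = refl
  sum-+ F G (v ∷ vs) = trans (cong ((F v + G v) +_) (sum-+ F G vs))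
    (solve 4 (λ a b c d → (a :+ b) :+ (c :+ d) := (a :+ c) :+ (b :+ d)) refl
      (F v) (G v) (sumℚ (L.map F vs)) (sumℚ (L.map G vs)))

  sum-*ʳ : ∀ (F : X → ℚ) r V → sumℚ (L.map (λ x → F x * r) V) ≡ sumℚ (L.map F V) * r
  sum-*ʳ F r [] = sym (*-zeroˡ r)
  sum-*ʳ F r (v ∷ vs) = trans (cong ((F v * r) +_) (sum-*ʳ F r vs))
    (sym (*-distribʳ-+ r (F v) (sumℚ (L.map F vs))))

  avg-map-cons : ∀ (F : X → ℚ) v vs →
    avg (L.map F (v ∷ vs)) ≡ sumℚ (L.map F (v ∷ vs)) * (Z.+ 1 / suc (L.length vs))
  avg-map-cons F v vs rewrite length-map F vs = refl

  -- count · average = sum (also for the empty list, where both sides are 0).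
  count*avg : ∀ (F : X → ℚ) V → count V * avg (L.map F V) ≡ sumℚ (L.map F V)
  count*avg F [] = refl
  count*avg F (v ∷ vs) = begin
    count (v ∷ vs) * avg (L.map F (v ∷ vs)) ≡⟨ cong₂ _*_ (count≡length (v ∷ vs)) (avg-map-cons F v vs) ⟩
    ι (suc k) * (Σ * r)                     ≡⟨ solve 3 (λ i s r → i :* (s :* r) := s :* (i :* r)) refl (ι (suc k)) Σ r ⟩
    Σ * (ι (suc k) * r)                     ≡⟨ cong (Σ *_) (ι-suc-inverse k) ⟩
    Σ * 1ℚ                                  ≡⟨ *-identityʳ Σ ⟩
    Σ                                       ∎
    where
    open ≡-Reasoning
    k = L.length vs
    Σ = sumℚ (L.map F (v ∷ vs))
    r = Z.+ 1 / suc k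

  avg-mono : ∀ (F G : X → ℚ) V →
    sumℚ (L.map F V) ≤ sumℚ (L.map G V) → avg (L.map F V) ≤ avg (L.map G V)
  avg-mono F G [] _ = ≤-refl
  avg-mono F G (v ∷ vs) F≤G rewrite avg-map-cons F v vs | avg-map-cons G v vs =
    *-monoʳ-≤-nonNeg (Z.+ 1 / suc (L.length vs)) {{normalize-nonNeg 1 (suc (L.length vs))}} F≤G

  accepted rejected : (X → Bool) → List X → List X
  accepted p V = L.filter (λ y → p y ≟B true) V
  rejected p V = L.filter (λ y → p y ≟B false) V

  sum-cut : ∀ (p : X → Bool) (F G H : X → ℚ) →
    (∀ y → p y ≡ true → F y ≡ G y) → (∀ y → p y ≡ false → F y ≡ H y) → ∀ V →
    sumℚ (L.map F V) ≡ sumℚ (L.map G (accepted p V)) + sumℚ (L.map H (rejected p V))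
  sum-cut p F G H F≡G F≡H [] = refl
  sum-cut p F G H F≡G F≡H (v ∷ vs) with p v in pv
  ... | true = trans (cong₂ _+_ (F≡G v pv) (sum-cut p F G H F≡G F≡H vs))
    (sym (+-assoc (G v) (sumℚ (L.map G (accepted p vs))) (sumℚ (L.map H (rejected p vs)))))
  ... | false = trans (cong₂ _+_ (F≡H v pv) (sum-cut p F G H F≡G F≡H vs))
    (solve 3 (λ a b c → a :+ (b :+ c) := b :+ (a :+ c)) refl
      (H v) (sumℚ (L.map G (accepted p vs))) (sumℚ (L.map H (rejected p vs))))

  filter-∧ : ∀ {P Q R : Pred X 0ℓ} (P? : Decidable P) (Q? : Decidable Q) (R? : Decidable R) →
    (∀ y → does (R? y) ≡ does (P? y) ∧ does (Q? y)) → ∀ V →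
    L.filter R? V ≡ L.filter Q? (L.filter P? V)
  filter-∧ P? Q? R? R≡P∧Q [] = refl
  filter-∧ P? Q? R? R≡P∧Q (v ∷ vs) with does (P? v) in pv
  ... | true with does (Q? v) in qv
  ...   | true  rewrite trans (R≡P∧Q v) (cong₂ _∧_ pv qv) = cong (v ∷_) (filter-∧ P? Q? R? R≡P∧Q vs)
  ...   | false rewrite trans (R≡P∧Q v) (cong₂ _∧_ pv qv) = filter-∧ P? Q? R? R≡P∧Q vs
  filter-∧ P? Q? R? R≡P∧Q (v ∷ vs) | false
    rewrite trans (R≡P∧Q v) (cong (_∧ does (Q? v)) pv) = filter-∧ P? Q? R? R≡P∧Q vs

sum-comm : ∀ {I Y : Set} (f : I → Y → ℚ) (Is : List I) (A : List Y) →
  sumℚ (L.map (λ i → sumℚ (L.map (f i) A)) Is) ≡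
  sumℚ (L.map (λ y → sumℚ (L.map (λ i → f i y) Is)) A)
sum-comm f Is [] = sum-zero Is
sum-comm f Is (a ∷ as) = trans (sum-+ (λ i → f i a) (λ i → sumℚ (L.map (f i) as)) Is)
  (cong (sumℚ (L.map (λ i → f i a) Is) +_) (sum-comm f Is as))

sum-of-avg : ∀ {I Y : Set} (f : I → Y → ℚ) (Is : List I) (A : List Y) →
  sumℚ (L.map (λ i → avg (L.map (f i) A)) Is) ≡
  avg (L.map (λ y → sumℚ (L.map (λ i → f i y) Is)) A)
sum-of-avg f Is [] = sum-zero Is
sum-of-avg f Is (a ∷ as) = begin
  sumℚ (L.map (λ i → avg (L.map (f i) (a ∷ as))) Is)
    ≡⟨ cong sumℚ (map-cong (λ i → avg-map-cons (f i) a as) Is) ⟩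
  sumℚ (L.map (λ i → sumℚ (L.map (f i) (a ∷ as)) * r) Is)
    ≡⟨ sum-*ʳ (λ i → sumℚ (L.map (f i) (a ∷ as))) r Is ⟩
  sumℚ (L.map (λ i → sumℚ (L.map (f i) (a ∷ as))) Is) * r
    ≡⟨ cong (_* r) (sum-comm f Is (a ∷ as)) ⟩
  sumℚ (L.map (λ y → sumℚ (L.map (λ i → f i y) Is)) (a ∷ as)) * r
    ≡⟨ sym (avg-map-cons (λ y → sumℚ (L.map (λ i → f i y) Is)) a as) ⟩
  avg (L.map (λ y → sumℚ (L.map (λ i → f i y) Is)) (a ∷ as)) ∎
  where
  open ≡-Reasoning
  r = Z.+ 1 / suc (L.length as)

module LeafEnergy {n : ℕ} (f : Input n → ℚ) where

  leafClass : PDT n → List (Input n) → Input n → List (Input n)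
  leafClass T U x = L.filter (λ y → ≡-dec _≟B_ (path T y) (path T x)) U

  mean : List (Input n) → ℚ
  mean U = avg (L.map f U)

  leafMean : PDT n → List (Input n) → Input n → ℚ
  leafMean T U x = mean (leafClass T U x)

  energy : PDT n → List (Input n) → ℚ
  energy T U = sumℚ (L.map (λ x → leafMean T U x * leafMean T U x) U)

  path-true : ∀ S (a b : PDT n) x → parity S x ≡ true → path (node S a b) x ≡ true ∷ path a x
  path-true S a b x px with parity S x
  path-true S a b x refl | true = refl

  path-false : ∀ S (a b : PDT n) x → parity S x ≡ false → path (node S a b) x ≡ false ∷ path b x
  path-false S a b x px with parity S x
  path-false S a b x refl | false = refl

  leafClass-true : ∀ S (a b : PDT n) U x → parity S x ≡ true →
    leafClass (node S a b) U x ≡ leafClass a (accepted (parity S) U) x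
  leafClass-true S a b U x px = filter-∧ _ _ _ same-leaf U
    where
    same-leaf : ∀ y → does (≡-dec _≟B_ (path (node S a b) y) (path (node S a b) x)) ≡
                      does (parity S y ≟B true) ∧ does (≡-dec _≟B_ (path a y) (path a x))
    same-leaf y rewrite path-true S a b x px with parity S y
    ... | true  = refl
    ... | false = refl

  leafClass-false : ∀ S (a b : PDT n) U x → parity S x ≡ false →
    leafClass (node S a b) U x ≡ leafClass b (rejected (parity S) U) x
  leafClass-false S a b U x px = filter-∧ _ _ _ same-leaf U
    where
    same-leaf : ∀ y → does (≡-dec _≟B_ (path (node S a b) y) (path (node S a b) x)) ≡
                      does (parity S y ≟B false) ∧ does (≡-dec _≟B_ (path b y) (path b x))
    same-leaf y rewrite path-false S a b x px with parity S y
    ... | true  = refl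
    ... | false = refl

  energy-node : ∀ S (a b : PDT n) U →
    energy (node S a b) U ≡ energy a (accepted (parity S) U) + energy b (rejected (parity S) U)
  energy-node S a b U = sum-cut (parity S) _ _ _
    (λ y py → cong (λ V → mean V * mean V) (leafClass-true S a b U y py))
    (λ y py → cong (λ V → mean V * mean V) (leafClass-false S a b U y py)) U

  -- A leaf has a single class, so its energy is |U| · (mean of f on U)².
  energy-leaf : ∀ U → energy leaf U ≡ count U * (mean U * mean U)
  energy-leaf U = trans
    (cong sumℚ (map-cong (λ x → cong (λ V → mean V * mean V)
                                      (filter-all _ (universal (λ _ → refl) U))) U))
    (sum-const U (mean U * mean U))

  energy-leaf-cut : ∀ (p : Input n → Bool) U →
    energy leaf U ≤ energy leaf (accepted p U) + energy leaf (rejected p U)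
  energy-leaf-cut p U = subst₂ _≤_
    (sym (trans (energy-leaf U) (cong (_* (mean U * mean U)) count-cut)))
    (sym (cong₂ _+_ (energy-leaf U₁) (energy-leaf U₀)))
    (weighted-jensen (count U₁) (count U₀) (mean U₁) (mean U₀) (mean U)
      (0≤count U₁) (0≤count U₀) mean-cut)
    where
    U₁ = accepted p U
    U₀ = rejected p U
    count-cut : count U ≡ count U₁ + count U₀
    count-cut = sum-cut p _ _ _ (λ _ _ → refl) (λ _ _ → refl) U
    mean-cut : count U₁ * mean U₁ + count U₀ * mean U₀ ≡ (count U₁ + count U₀) * mean U
    mean-cut = begin
      count U₁ * mean U₁ + count U₀ * mean U₀ ≡⟨ cong₂ _+_ (count*avg f U₁) (count*avg f U₀) ⟩
      sumℚ (L.map f U₁) + sumℚ (L.map f U₀)   ≡⟨ sym (sum-cut p f f f (λ _ _ → refl) (λ _ _ → refl) U) ⟩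
      sumℚ (L.map f U)                        ≡⟨ sym (count*avg f U) ⟩
      count U * mean U                        ≡⟨ cong (_* mean U) count-cut ⟩
      (count U₁ + count U₀) * mean U          ∎
      where open ≡-Reasoning

  energy-leaf-≤ : ∀ T' U → energy leaf U ≤ energy T' U
  energy-leaf-≤ leaf U = ≤-refl
  energy-leaf-≤ (node S a b) U = begin
    energy leaf U
      ≤⟨ energy-leaf-cut (parity S) U ⟩
    energy leaf (accepted (parity S) U) + energy leaf (rejected (parity S) U)
      ≤⟨ +-mono-≤ (energy-leaf-≤ a (accepted (parity S) U)) (energy-leaf-≤ b (rejected (parity S) U)) ⟩
    energy a (accepted (parity S) U) + energy b (rejected (parity S) U)
      ≡⟨ sym (energy-node S a b U) ⟩
    energy (node S a b) U ∎
    where open ≤-Reasoning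

  energy-mono : ∀ {T T'} → T ≼ T' → ∀ U → energy T U ≤ energy T' U
  energy-mono (leaf≼ T') U = energy-leaf-≤ T' U
  energy-mono (node≼ {S} {a} {b} {a'} {b'} a≼a' b≼b') U
    rewrite energy-node S a b U | energy-node S a' b' U =
    +-mono-≤ (energy-mono a≼a' (accepted (parity S) U)) (energy-mono b≼b' (rejected (parity S) U))

coordinateSum : {n : ℕ} → Input n → ℚ
coordinateSum {n} y = sumFin n (λ i → sgn (V.lookup y i))

-- Σ_i ℓ_i for the leaf reached by x is the mean of coordinateSum over that leaf,
-- so the potential is the averaged leaf energy for the weight coordinateSum.
potential≡avg-leafMean² : ∀ {n} (T : PDT n) → let open LeafEnergy (coordinateSum {n}) in
  potential T ≡ avg (L.map (λ x → leafMean T (allInputs n) x * leafMean T (allInputs n) x) (allInputs n))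
potential≡avg-leafMean² {n} T = cong avg (map-cong (λ x → cong₂ _*_ (leafSum x) (leafSum x)) (allInputs n))
  where
  open LeafEnergy (coordinateSum {n})
  leafSum : ∀ x → sumFin n (leafVec T x) ≡ leafMean T (allInputs n) x
  leafSum x = sum-of-avg (λ i y → sgn (V.lookup y i)) (L.allFin n) (reachers T x)

proposition6 : (n : ℕ) (T T' : PDT n) → T ≼ T' → potential T ≤ potential T'
proposition6 n T T' T≼T' =
  subst₂ _≤_ (sym (potential≡avg-leafMean² T)) (sym (potential≡avg-leafMean² T'))
    (avg-mono _ _ (allInputs n) (energy-mono T≼T' (allInputs n)))
  where open LeafEnergy (coordinateSum {n})
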